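{- Let $D$ be a finite digraph without sources or sinks, let $n\ge 1$, let $U\subseteq V(D)$, and let $W\subseteq E(D)=V(L(D))$ be the set of edges of $D$ whose heads lie in $U$. Then $U$ is an $n$th-order coreset of $D$ if and only if $W$ is an $(n+1)$th-order coreset of $L(D)$.
   Context: Digraphs are finite; loops allowed, no multiple edges. A sink is a vertex with no successors, a source a vertex with no predecessors. The line digraph $L(D)$ has vertex set $E(D)$ and an edge from $e$ to $f$ iff the head of $e$ is the tail of $f$. A walk of length $n$ from $u$ to $v$ is a sequence $u=v_0,\ldots,v_n=v$ with $v_{k-1}v_k$ an edge for each $k$. In a digraph $H$ and for $S\subseteq V(H)$, $\alpha^n(S)$ is the set of vertices reachable by a walk of length $n$ from a vertex of $S$, and $\beta^n(S)$ the set of vertices from which some vertex of $S$ is reachable by a walk of length $n$. $H^n$ is the digraph on $V(H)$ with an edge $uv$ iff $H$ has a walk of length $n$ from $u$ to $v$. The $n$th-order coresets of $H$ are the coresets of $H^n$, where a coreset of a digraph $G$ is either the set of all sinks of $G$ or a minimal nonempty set $U\subseteq V(G)$ with $\beta_G(\alpha_G(U))=U$ ($\alpha_G,\beta_G$ being successor and predecessor sets in $G$). For $H$ without sources or sinks, the $n$th-order coresets are exactly the minimal nonempty sets $U$ with $\beta^n(\alpha^n(U))=U$. -}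

module Defs where

open import Data.Nat using (ℕ; zero; suc)
open import Data.Fin using (Fin)
open import Data.Bool using (Bool; T)
open import Data.Product using (Σ; ∃; _×_; _,_; proj₁; proj₂)
open import Data.Sum using (_⊎_)
open import Relation.Nullary using (¬_)
open import Relation.Binary.PropositionalEquality using (_≡_)
open import Relation.Unary using (Pred; _⊆_; _∈_)
open import Level using (0ℓ)

-- A (general) digraph: vertex type and edge relation (loops allowed; no multiple edges).
record Digraph : Set₁ where
  field
    V : Set
    E : V → V → Set
open Digraph public

Subset : Digraph → Set₁
Subset G = Pred (V G) 0ℓ

_≐_ : {A : Set} → Pred A 0ℓ → Pred A 0ℓ → Set
U ≐ U' = (U ⊆ U') × (U' ⊆ U)

data Walk (G : Digraph) : ℕ → V G → V G → Set where
  here : ∀ {u} → Walk G zero u u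
  step : ∀ {n u w v} → E G u w → Walk G n w v → Walk G (suc n) u v

pow : Digraph → ℕ → Digraph
pow G n = record { V = V G ; E = Walk G n }

IsSink : (G : Digraph) → V G → Set
IsSink G u = ∀ v → ¬ E G u v

IsSource : (G : Digraph) → V G → Set
IsSource G v = ∀ u → ¬ E G u v

α : (G : Digraph) → Subset G → Subset G
α G U v = ∃ λ u → U u × E G u v

β : (G : Digraph) → Subset G → Subset G
β G S u = ∃ λ v → S v × E G u v

Nonempty : {A : Set} → Pred A 0ℓ → Set
Nonempty {A} U = Σ A U

MinFixed : (G : Digraph) → Subset G → Set₁
MinFixed G U =
  Nonempty U × (β G (α G U) ≐ U) ×
  ((U' : Subset G) → Nonempty U' → β G (α G U') ≐ U' → U' ⊆ U → U ≐ U')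

Coreset : (G : Digraph) → Subset G → Set₁
Coreset G U = (Nonempty (IsSink G) × (U ≐ IsSink G)) ⊎ MinFixed G U

CoresetOrder : (H : Digraph) → ℕ → Subset H → Set₁
CoresetOrder H n U = Coreset (pow H n) U

finDigraph : (k : ℕ) → (Fin k → Fin k → Bool) → Digraph
finDigraph k adj = record { V = Fin k ; E = λ u v → T (adj u v) }

Edge : Digraph → Set
Edge G = Σ (V G × V G) (λ p → E G (proj₁ p) (proj₂ p))

tail head : {G : Digraph} → Edge G → V G
tail e = proj₁ (proj₁ e)
head e = proj₂ (proj₁ e)

L : Digraph → Digraph
L G = record { V = Edge G ; E = λ e f → head {G} e ≡ tail {G} f }

headsIn : (G : Digraph) → Subset G → Subset (L G)
headsIn G U e = U (head {G} e)

-- A walk of length m+1 in L(D) from e to f is the same thing as a walk of length m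
-- in D from the head of e to the tail of f.  Hence, when D has neither sources nor
-- sinks, βα computed in L(D)^(n+1) on the set of edges with heads in U is the set of
-- edges with heads in βα(U) computed in D^n, and the (n+1)th-order βα-closure of any
-- edge set depends only on heads.  So the fixed sets of L(D)^(n+1) are exactly the
-- edge sets "heads in U" for fixed U of D^n, and U ↦ headsIn U preserves and reflects
-- inclusion; minimality transfers both ways.  Powers of a sinkless digraph have no
-- sinks, so only the minimal-fixed-set kind of coreset occurs on either side.
module Submission where

open import Defs
open import Data.Nat using (ℕ; zero; suc; _≥_)
open import Data.Fin using (Fin)
open import Data.Bool using (Bool)
open import Data.Bool.Properties using (T?)
open import Data.Fin.Properties using (any?)
open import Data.Product using (Σ; ∃; _×_; _,_)
open import Data.Sum using (inj₁; inj₂)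
open import Data.Empty using (⊥-elim)
open import Function using (_∘_)
open import Function.Bundles using (_⇔_; mk⇔; Equivalence)
open import Relation.Nullary using (¬_; yes; no)
open import Relation.Binary.PropositionalEquality using (_≡_; refl; subst)
open import Relation.Unary using (_⊆_)
open import Relation.Unary.Properties using (≐-sym; ≐-trans)

open Equivalence using (to; from)

HasSuccessors : Digraph → Set
HasSuccessors G = ∀ u → Σ (V G) (E G u)

HasPredecessors : Digraph → Set
HasPredecessors G = ∀ v → Σ (V G) (λ u → E G u v)

Fixed : (G : Digraph) → Subset G → Set
Fixed G S = β G (α G S) ≐ S

βα-mono : (G : Digraph) {S T : Subset G} → S ⊆ T → β G (α G S) ⊆ β G (α G T)
βα-mono G S⊆T (v , (u , Su , uv) , wv) = v , (u , S⊆T Su , uv) , wv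

Fixed-resp-≐ : (G : Digraph) {S T : Subset G} → S ≐ T → Fixed G S → Fixed G T
Fixed-resp-≐ G (S⊆T , T⊆S) (βαS⊆S , S⊆βαS) =
  (λ h → S⊆T (βαS⊆S (βα-mono G T⊆S h))) , (λ h → βα-mono G S⊆T (S⊆βαS (T⊆S h)))

walkFrom : (G : Digraph) → HasSuccessors G → ∀ n u → Σ (V G) (Walk G n u)
walkFrom G succ zero    u = u , here
walkFrom G succ (suc n) u =
  let w , uw = succ u ; v , wv = walkFrom G succ n w in v , step uw wv

pow-noSink : (G : Digraph) → HasSuccessors G → ∀ n → ¬ Nonempty (IsSink (pow G n))
pow-noSink G succ n (u , sink) = let v , uv = walkFrom G succ n u in sink v uv

Coreset⇒MinFixed : (G : Digraph) → HasSuccessors G → ∀ n {S : Subset G} →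
                   CoresetOrder G n S → MinFixed (pow G n) S
Coreset⇒MinFixed G succ n (inj₁ (sinks , _)) = ⊥-elim (pow-noSink G succ n sinks)
Coreset⇒MinFixed G succ n (inj₂ minFixed)   = minFixed

lineWalk⇒walk : (D : Digraph) (m : ℕ) {e f : Edge D} →
                Walk (L D) (suc m) e f → Walk D m (head {D} e) (tail {D} f)
lineWalk⇒walk D zero    (step refl here)               = here
lineWalk⇒walk D (suc m) (step {w = (_ , bc)} refl ef) = step bc (lineWalk⇒walk D m ef)

walk⇒lineWalk : (D : Digraph) (m : ℕ) {e f : Edge D} →
                Walk D m (head {D} e) (tail {D} f) → Walk (L D) (suc m) e f
walk⇒lineWalk D zero    here          = step refl here
walk⇒lineWalk D (suc m) (step bc cf) = step refl (walk⇒lineWalk D m {e = (_ , bc)} cf)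

L-successors : (D : Digraph) → HasSuccessors D → HasSuccessors (L D)
L-successors D succ ((_ , b) , _) = let c , bc = succ b in ((b , c) , bc) , refl

module LinePower (D : Digraph) (succ : HasSuccessors D) (pred : HasPredecessors D) (n : ℕ) where

  Dⁿ Lⁿ⁺¹ : Digraph
  Dⁿ   = pow D n
  Lⁿ⁺¹ = pow (L D) (suc n)

  hd tl : Edge D → V D
  hd = head {D}
  tl = tail {D}

  edgeInto edgeOutOf : V D → Edge D
  edgeInto  v = let u , uv = pred v in (u , v) , uv
  edgeOutOf u = let v , uv = succ u in (u , v) , uv

  headsOf : Subset (L D) → Subset D
  headsOf W v = ∃ λ e → hd e ≡ v × W e

  βα-headsIn⊆ : {U : Subset D} → β Lⁿ⁺¹ (α Lⁿ⁺¹ (headsIn D U)) ⊆ headsIn D (β Dⁿ (α Dⁿ U))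
  βα-headsIn⊆ (f , (e′ , Ue′ , e′f) , ef) =
    tl f , (hd e′ , Ue′ , lineWalk⇒walk D n e′f) , lineWalk⇒walk D n ef

  βα-headsIn⊇ : {U : Subset D} → headsIn D (β Dⁿ (α Dⁿ U)) ⊆ β Lⁿ⁺¹ (α Lⁿ⁺¹ (headsIn D U))
  βα-headsIn⊇ (v , (u , Uu , uv) , ev) =
    edgeOutOf v , (edgeInto u , Uu , walk⇒lineWalk D n uv) , walk⇒lineWalk D n ev

  β-head-invariant : {S : Subset (L D)} {e e′ : Edge D} → hd e ≡ hd e′ → β Lⁿ⁺¹ S e → β Lⁿ⁺¹ S e′
  β-head-invariant eq (f , Sf , ef) =
    f , Sf , walk⇒lineWalk D n (subst (λ v → Walk D n v (tl f)) eq (lineWalk⇒walk D n ef))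

  Fixed-headsIn : {U : Subset D} → Fixed Dⁿ U ⇔ Fixed Lⁿ⁺¹ (headsIn D U)
  Fixed-headsIn = mk⇔
    (λ (βαU⊆U , U⊆βαU) → (βαU⊆U ∘ βα-headsIn⊆) , (βα-headsIn⊇ ∘ U⊆βαU))
    (λ (βαW⊆W , W⊆βαW) →
       (λ {v} → βαW⊆W ∘ βα-headsIn⊇ {x = edgeInto v}) ,
       (λ {v} → βα-headsIn⊆ {x = edgeInto v} ∘ W⊆βαW))

  Fixed⇒headsIn-headsOf : {W : Subset (L D)} → Fixed Lⁿ⁺¹ W → W ≐ headsIn D (headsOf W)
  Fixed⇒headsIn-headsOf (βαW⊆W , W⊆βαW) =
    (λ {e} We → e , refl , We) ,
    (λ (e′ , eq , We′) → βαW⊆W (β-head-invariant eq (W⊆βαW We′)))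

  headsIn-resp-≐ : {U U′ : Subset D} → U ≐ U′ → headsIn D U ≐ headsIn D U′
  headsIn-resp-≐ (U⊆U′ , U′⊆U) = U⊆U′ , U′⊆U

  headsIn-reflects-≐ : {U U′ : Subset D} → headsIn D U ≐ headsIn D U′ → U ≐ U′
  headsIn-reflects-≐ (W⊆W′ , W′⊆W) = (λ {v} → W⊆W′ {edgeInto v}) , (λ {v} → W′⊆W {edgeInto v})

  MinFixed-headsIn : {U : Subset D} → MinFixed Dⁿ U → MinFixed Lⁿ⁺¹ (headsIn D U)
  MinFixed-headsIn {U} ((u , Uu) , fixedU , minimal) =
    (edgeInto u , Uu) , to Fixed-headsIn fixedU , minimal′
    where
    minimal′ : (W : Subset (L D)) → Nonempty W → Fixed Lⁿ⁺¹ W → W ⊆ headsIn D U → headsIn D U ≐ W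
    minimal′ W (e , We) fixedW W⊆U = ≐-trans (headsIn-resp-≐ U≐U′) (≐-sym W≐)
      where
      W≐ : W ≐ headsIn D (headsOf W)
      W≐ = Fixed⇒headsIn-headsOf fixedW
      U≐U′ : U ≐ headsOf W
      U≐U′ = minimal (headsOf W) (hd e , e , refl , We)
                     (from Fixed-headsIn (Fixed-resp-≐ Lⁿ⁺¹ W≐ fixedW))
                     (λ { (_ , refl , We′) → W⊆U We′ })

  MinFixed-headsIn⁻ : {U : Subset D} → MinFixed Lⁿ⁺¹ (headsIn D U) → MinFixed Dⁿ U
  MinFixed-headsIn⁻ {U} ((e , Ue) , fixedW , minimal) =
    (hd e , Ue) , from Fixed-headsIn fixedW , minimal′
    where
    minimal′ : (U′ : Subset D) → Nonempty U′ → Fixed Dⁿ U′ → U′ ⊆ U → U ≐ U′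
    minimal′ U′ (u , U′u) fixedU′ U′⊆U = headsIn-reflects-≐ {U} {U′}
      (minimal (headsIn D U′) (edgeInto u , U′u) (to Fixed-headsIn fixedU′) U′⊆U)

  Coreset-headsIn : {U : Subset D} → CoresetOrder D n U ⇔ CoresetOrder (L D) (suc n) (headsIn D U)
  Coreset-headsIn = mk⇔
    (inj₂ ∘ MinFixed-headsIn ∘ Coreset⇒MinFixed D succ n)
    (inj₂ ∘ MinFixed-headsIn⁻ ∘ Coreset⇒MinFixed (L D) (L-successors D succ) (suc n))

module _ {k : ℕ} (adj : Fin k → Fin k → Bool) where

  finDigraph-successors : (∀ v → ¬ IsSink (finDigraph k adj) v) → HasSuccessors (finDigraph k adj)
  finDigraph-successors noSink u with any? (λ v → T? (adj u v))
  ... | yes uv = uv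
  ... | no ¬uv = ⊥-elim (noSink u (λ v t → ¬uv (v , t)))

  finDigraph-predecessors : (∀ v → ¬ IsSource (finDigraph k adj) v) → HasPredecessors (finDigraph k adj)
  finDigraph-predecessors noSource v with any? (λ u → T? (adj u v))
  ... | yes uv = uv
  ... | no ¬uv = ⊥-elim (noSource v (λ u t → ¬uv (u , t)))

lemma8 : (k : ℕ) (adj : Fin k → Fin k → Bool) →
         let D = finDigraph k adj in
         (∀ v → ¬ IsSource D v) → (∀ v → ¬ IsSink D v) →
         (n : ℕ) → n ≥ 1 → (U : Subset D) →
         CoresetOrder D n U ⇔ CoresetOrder (L D) (suc n) (headsIn D U)
lemma8 k adj noSource noSink n _ U =
  LinePower.Coreset-headsIn (finDigraph k adj)
    (finDigraph-successors adj noSink) (finDigraph-predecessors adj noSource) n
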